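{- For the game $CSG(\{1,2,4\})$ and every integer $k\ge 0$, $\mathcal{G}(S_{2,2,k})=|S_{2,2,k}|\bmod 3=(k+5)\bmod 3$.
   Context: For a set $L$ of positive integers, the game $CSG(L)$ on a connected graph $G$ is the two-player impartial game in which a move consists in removing from the current graph a connected subgraph $H$ such that $|V(H)|\in L$ and the remaining graph is connected (the empty graph counts as connected, so removing the whole graph is allowed when its size is in $L$). The player unable to move loses. $\mathcal{G}(G)$ is the Grundy value of $CSG(\{1,2,4\})$ on $G$. The subdivided star $S_{\ell_1,\ldots,\ell_t}$ is obtained from a central vertex by attaching $t$ disjoint paths with $\ell_1,\ldots,\ell_t$ vertices (paths with $0$ vertices allowed); $|G|$ is the number of vertices. -}

module Defs where

open import Data.Bool using (Bool; true; false; _∧_; _∨_; not; if_then_else_)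
open import Data.Nat using (ℕ; zero; suc; _+_; _∸_; _≡ᵇ_; _<ᵇ_)
open import Data.Fin using (Fin; toℕ)
open import Data.Fin.Subset using (Subset; ⊤; ⊥; _─_; ∣_∣)
open import Data.Vec using (Vec; []; _∷_; lookup; zipWith; tabulate)
open import Data.List using (List; []; _∷_; map; filter; length; concatMap; foldr)
open import Data.Nat.ListAction using (sum)
open import Data.Maybe using (Maybe; just; nothing)
open import Data.Product using (_×_; _,_)
open import Relation.Nullary.Decidable using (Dec; yes; no)
open import Data.Bool using (T)
open import Data.Bool.Properties using (T?)

-- Finite simple graphs on the vertex set Fin size (adjacency as a Bool
-- relation; it is symmetric and irreflexive for the graphs we build).

record Graph : Set where
  field
    size : ℕ
    adj  : Fin size → Fin size → Bool
open Graph public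

allSubsets : (n : ℕ) → List (Subset n)
allSubsets zero    = [] ∷ []
allSubsets (suc n) = concatMap (λ s → (true ∷ s) ∷ (false ∷ s) ∷ []) (allSubsets n)

subsetᵇ : ∀ {n} → Subset n → Subset n → Bool
subsetᵇ []       []       = true
subsetᵇ (a ∷ s)  (b ∷ t)  = (not a ∨ b) ∧ subsetᵇ s t

emptyᵇ : ∀ {n} → Subset n → Bool
emptyᵇ []      = true
emptyᵇ (a ∷ s) = not a ∧ emptyᵇ s

firstElem : ∀ {n} → Subset n → Maybe (Fin n)
firstElem []          = nothing
firstElem (true ∷ s)  = just Fin.zero
  where import Data.Fin as Fin
firstElem (false ∷ s) with firstElem s
... | just i  = just (Fin.suc i)
  where import Data.Fin as Fin
... | nothing = nothing

anyᵇ : ∀ {n} → (Fin n → Bool) → Bool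
anyᵇ {n} p = foldr _∨_ false (Data.List.map p (Data.List.allFin n))
  where import Data.List

-- S is connected iff S is empty or every vertex of S is
-- reachable (within S) from the first vertex of S; walks of length
-- < size G suffice.

reach : (G : Graph) → Subset (size G) → Fin (size G) → ℕ → Subset (size G)
reach G S u zero    = tabulate (λ w → (toℕ w ≡ᵇ toℕ u) ∧ lookup S w)
reach G S u (suc m) =
  let R = reach G S u m in
  tabulate (λ w → lookup R w ∨
                  (lookup S w ∧ anyᵇ (λ v → lookup R v ∧ adj G v w)))

connectedᵇ : (G : Graph) → Subset (size G) → Bool
connectedᵇ G S with firstElem S
... | nothing = true
... | just u  = subsetᵇ S (reach G S u (size G))

memᵇ : ℕ → List ℕ → Bool
memᵇ x []       = false
memᵇ x (y ∷ ys) = (x ≡ᵇ y) ∨ memᵇ x ys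

mexFrom : ℕ → ℕ → List ℕ → ℕ
mexFrom i zero    xs = i
mexFrom i (suc f) xs = if memᵇ i xs then mexFrom (suc i) f xs else i

mex : List ℕ → ℕ
mex xs = mexFrom 0 (suc (length xs)) xs

-- A position is the set S of remaining vertices of G (the current graph
-- is the subgraph induced by S).  A move removes a set H ⊆ S with |H| ∈ L,
-- H inducing a connected subgraph and S ─ H inducing a connected graph
-- (the empty graph counts as connected).

moves : (L : ℕ → Bool) (G : Graph) → Subset (size G) → List (Subset (size G))
moves L G S = filter (λ H → T? (subsetᵇ H S ∧ L ∣ H ∣ ∧ connectedᵇ G H
                                ∧ connectedᵇ G (S ─ H)))
                     (allSubsets (size G))

-- Grundy value by recursion on a fuel bound (every move removes at least
-- one vertex when 0 ∉ L, so fuel = size G suffices from any position).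
grundyFuel : (L : ℕ → Bool) (G : Graph) → ℕ → Subset (size G) → ℕ
grundyFuel L G zero    S = 0
grundyFuel L G (suc f) S = mex (map (λ H → grundyFuel L G f (S ─ H)) (moves L G S))

grundyCSG : (L : ℕ → Bool) → Graph → ℕ
grundyCSG L G = grundyFuel L G (size G) ⊤

L124 : ℕ → Bool
L124 n = (n ≡ᵇ 1) ∨ (n ≡ᵇ 2) ∨ (n ≡ᵇ 4)

𝒢 : Graph → ℕ
𝒢 = grundyCSG L124

-- Subdivided star S_{ℓ₁,…,ℓ_t}: vertex 0 is the centre; the remaining
-- vertices 1,…,Σℓᵢ are the path vertices listed path by path, each path
-- in order starting from the vertex adjacent to the centre.

-- locate ls j i: the i-th (0-based) non-centre vertex lies on path
-- number j + (path index) at 0-based position p along that path.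
locate : List ℕ → ℕ → ℕ → Maybe (ℕ × ℕ)
locate []       j i = nothing
locate (l ∷ ls) j i = if i <ᵇ l then just (j , i) else locate ls (suc j) (i ∸ l)

adjStarℕ : List ℕ → ℕ → ℕ → Bool
adjStarℕ ls zero    zero    = false
adjStarℕ ls zero    (suc b) with locate ls 0 b
... | just (_ , p) = p ≡ᵇ 0
... | nothing      = false
adjStarℕ ls (suc a) zero    with locate ls 0 a
... | just (_ , p) = p ≡ᵇ 0
... | nothing      = false
adjStarℕ ls (suc a) (suc b) with locate ls 0 a | locate ls 0 b
... | just (j , p) | just (j' , q) = (j ≡ᵇ j') ∧ ((suc p ≡ᵇ q) ∨ (suc q ≡ᵇ p))
... | _            | _             = false

subdividedStar : List ℕ → Graph
subdividedStar ls = record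
  { size = suc (sum ls)
  ; adj  = λ u v → adjStarℕ ls (toℕ u) (toℕ v)
  }

∣_∣ᵥ : Graph → ℕ
∣ G ∣ᵥ = size G

-- Every nonempty connected vertex set S of S_{2,2,k} has a leaf, and removing it is a legal
-- move of size 1; when |S| ≡ 2 (mod 3) it also has a pendant edge (a leaf whose neighbour
-- becomes a leaf once it is gone), and removing that edge is a legal move of size 2. Since
-- 1, 2 and 4 are nonzero mod 3, induction on |S| gives 𝒢(S) = |S| mod 3: the options reach
-- every residue below |S| mod 3 but never |S| mod 3 itself. Viewing the spider as a tree
-- hanging from its centre, the largest vertex of S is a leaf, and it lies on a pendant edge
-- unless its parent is the centre; in that case either a whole two-vertex arm lies in S, or
-- the centre has two further neighbours in S, which forces {0,1,3} ⊆ S ⊆ {0,1,3,5} and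
-- |S| ∈ {3,4}.
module Submission where

open import Defs
open import Data.Nat using (ℕ; _+_; _%_)
open import Data.List using (List; []; _∷_)
open import Data.Product using (_×_)
open import Relation.Binary.PropositionalEquality using (_≡_)

open import Data.Bool using (Bool; true; false; T; _∧_; _∨_)
open import Data.Bool.Properties using (T-∧; T-∨; T-≡; T?; ∨-comm)
open import Data.Empty using (⊥-elim)
open import Data.Fin using (Fin; zero; suc; toℕ; fromℕ<; #_) renaming (_≟_ to _≟ᶠ_)
open import Data.Fin.Properties using (toℕ-injective; toℕ<n; toℕ-fromℕ<)
open import Data.Fin.Subset
  using (Subset; _∈_; _∉_; _⊆_; ⁅_⁆; _∪_; _─_; _-_; ∣_∣; ⊤; Nonempty; Empty; outside; inside)
open import Data.Fin.Subset.Properties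
  using ( _∈?_; nonempty?; Empty-unique; drop-there; ∈⊤; x∈⁅y⁆⇒x≡y; x∉⁅y⁆⇒x≢y; x∈p∪q⁻
        ; x∈p∧x≢y⇒x∈p-y; p─q⊆p; p─q─r≡p─q∪r; ∪-identityˡ; ∪-identityʳ
        ; ∣⊥∣≡0; ∣⁅x⁆∣≡1; ∣p∣≤n; ∣⊤∣≡n; ∣p∣≡n⇒p≡⊤; p⊆q⇒∣p∣≤∣q∣)
open import Data.List using (allFin; map; length)
open import Data.List.Membership.Propositional using (lose) renaming (_∈_ to _∈ˡ_)
open import Data.List.Membership.Propositional.Properties
  using (∈-allFin; ∈-filter⁺; ∈-filter⁻; ∈-concatMap⁺; ∈-map⁺; ∈-map⁻)
open import Data.List.Relation.Unary.Any as Any using (here; there; satisfied)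
open import Data.List.Relation.Unary.Any.Properties using (any⁺; any⁻)
open import Data.Maybe using (just; nothing)
open import Data.Nat using (zero; suc; _≤_; _<_; z≤n; s≤s; s≤s⁻¹; _∸_; _*_; _≡ᵇ_; _<ᵇ_; NonZero)
open import Data.Nat.DivMod using (%-distribˡ-+; m%n%n≡m%n; [m+kn]%n≡m%n; m%n<n; m<n⇒m%n≡m)
open import Data.Nat.Properties as ℕ using (≡ᵇ⇒≡; ≡⇒≡ᵇ)
open import Data.Product using (∃; _,_; proj₁; proj₂)
open import Data.Sum using (_⊎_; inj₁; inj₂; swap)
open import Data.Vec using ([]; _∷_; lookup; tabulate; here; there)
open import Data.Vec.Properties using (lookup∘tabulate)
open import Function using (_∘_; case_of_; _⇔_; mk⇔; Equivalence)
open import Relation.Nullary using (¬_; yes; no; _×-dec_)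
open import Relation.Binary.PropositionalEquality
  using (_≢_; refl; sym; trans; cong; cong₂; subst; module ≡-Reasoning)

∈⇒T-lookup : ∀ {n} {x : Fin n} {p : Subset n} → x ∈ p → T (lookup p x)
∈⇒T-lookup here        = _
∈⇒T-lookup (there x∈p) = ∈⇒T-lookup x∈p

T-lookup⇒∈ : ∀ {n} (p : Subset n) x → T (lookup p x) → x ∈ p
T-lookup⇒∈ (true ∷ p) zero    _ = here
T-lookup⇒∈ (_    ∷ p) (suc x) t = there (T-lookup⇒∈ p x t)

∈-tabulate⁻ : ∀ {n} (f : Fin n → Bool) {x} → x ∈ tabulate f → T (f x)
∈-tabulate⁻ f {x} x∈ = subst T (lookup∘tabulate f x) (∈⇒T-lookup x∈)

∈-tabulate⁺ : ∀ {n} (f : Fin n → Bool) {x} → T (f x) → x ∈ tabulate f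
∈-tabulate⁺ f {x} t = T-lookup⇒∈ (tabulate f) x (subst T (sym (lookup∘tabulate f x)) t)

subsetᵇ-sound : ∀ {n} (p q : Subset n) → T (subsetᵇ p q) → p ⊆ q
subsetᵇ-sound (true ∷ p) (true ∷ q) t here        = here
subsetᵇ-sound (_    ∷ p) (_    ∷ q) t (there x∈p) =
  there (subsetᵇ-sound p q (proj₂ (Equivalence.to T-∧ t)) x∈p)

subsetᵇ-complete : ∀ {n} (p q : Subset n) → p ⊆ q → T (subsetᵇ p q)
subsetᵇ-complete []          []          p⊆q = _
subsetᵇ-complete (false ∷ p) (_     ∷ q) p⊆q = subsetᵇ-complete p q (drop-there ∘ p⊆q ∘ there)
subsetᵇ-complete (true  ∷ p) (true  ∷ q) p⊆q = subsetᵇ-complete p q (drop-there ∘ p⊆q ∘ there)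
subsetᵇ-complete (true  ∷ p) (false ∷ q) p⊆q with p⊆q here
... | ()

firstElem-just : ∀ {n} (p : Subset n) {u} → firstElem p ≡ just u → u ∈ p
firstElem-just (true  ∷ p) refl = here
firstElem-just (false ∷ p) eq with firstElem p in eq′
firstElem-just (false ∷ p) refl | just _ = there (firstElem-just p eq′)

firstElem-nothing : ∀ {n} (p : Subset n) → firstElem p ≡ nothing → Empty p
firstElem-nothing (true  ∷ p) () _
firstElem-nothing (false ∷ p) eq x∈ with firstElem p in eq′
firstElem-nothing (false ∷ p) () _                   | just _
firstElem-nothing (false ∷ p) eq (suc x , there x∈p) | nothing = firstElem-nothing p eq′ (x , x∈p)

anyᵇ-sound : ∀ {n} (f : Fin n → Bool) → T (anyᵇ f) → ∃ λ x → T (f x)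
anyᵇ-sound {n} f t = satisfied (any⁻ f (allFin n) t)

anyᵇ-complete : ∀ {n} (f : Fin n → Bool) x → T (f x) → T (anyᵇ f)
anyᵇ-complete f x t = any⁺ f (lose (∈-allFin x) t)

memᵇ-sound : ∀ x xs → T (memᵇ x xs) → x ∈ˡ xs
memᵇ-sound x (y ∷ xs) t with Equivalence.to T-∨ t
... | inj₁ x≡y = here (≡ᵇ⇒≡ x y x≡y)
... | inj₂ x∈  = there (memᵇ-sound x xs x∈)

memᵇ-complete : ∀ x xs → x ∈ˡ xs → T (memᵇ x xs)
memᵇ-complete x (y ∷ xs) (here refl) = Equivalence.from T-∨ (inj₁ (≡⇒≡ᵇ x x refl))
memᵇ-complete x (y ∷ xs) (there x∈)  = Equivalence.from T-∨ (inj₂ (memᵇ-complete x xs x∈))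

∈-allSubsets : ∀ n (p : Subset n) → p ∈ˡ allSubsets n
∈-allSubsets zero    []      = here refl
∈-allSubsets (suc n) (b ∷ p) =
  ∈-concatMap⁺ (λ s → (true ∷ s) ∷ (false ∷ s) ∷ []) (Any.map (extend b) (∈-allSubsets n p))
  where
  extend : ∀ b {s} → p ≡ s → (b ∷ p) ∈ˡ ((true ∷ s) ∷ (false ∷ s) ∷ [])
  extend true  refl = here refl
  extend false refl = there (here refl)

<ᵇ-true : ∀ {m n} → m < n → (m <ᵇ n) ≡ true
<ᵇ-true m<n = Equivalence.to T-≡ (ℕ.<⇒<ᵇ m<n)

≡ᵇ-comm : ∀ a b → (a ≡ᵇ b) ≡ (b ≡ᵇ a)
≡ᵇ-comm zero    zero    = refl
≡ᵇ-comm zero    (suc b) = refl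
≡ᵇ-comm (suc a) zero    = refl
≡ᵇ-comm (suc a) (suc b) = ≡ᵇ-comm a b

x∈p─q⇒x∉q : ∀ {n} (p q : Subset n) {x} → x ∈ p ─ q → x ∉ q
x∈p─q⇒x∉q (_ ∷ p) (inside ∷ q) ()         here
x∈p─q⇒x∉q (_ ∷ p) (_      ∷ q) (there x∈) (there x∈q) = x∈p─q⇒x∉q p q x∈ x∈q

x∈p-y⁻ : ∀ {n} (p : Subset n) {x y} → x ∈ p - y → x ∈ p × x ≢ y
x∈p-y⁻ p {y = y} x∈ = p─q⊆p p ⁅ y ⁆ x∈ , x∉⁅y⁆⇒x≢y (x∈p─q⇒x∉q p ⁅ y ⁆ x∈)

⁅x⁆⊆p : ∀ {n} {p : Subset n} {x} → x ∈ p → ⁅ x ⁆ ⊆ p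
⁅x⁆⊆p {p = p} {x} x∈p y∈ = subst (_∈ p) (sym (x∈⁅y⁆⇒x≡y x y∈)) x∈p

maximum : ∀ {n} (p : Subset n) → Nonempty p → ∃ λ m → m ∈ p × (∀ {y} → y ∈ p → toℕ y ≤ toℕ m)
maximum (b ∷ p) ne with nonempty? p
maximum (b ∷ p) ne                  | yes nep =
  let m , m∈p , m-max = maximum p nep in
  suc m , there m∈p , λ { here → z≤n ; (there y∈p) → s≤s (m-max y∈p) }
maximum (b ∷ p) (zero  , here)      | no ¬nep =
  zero , here , λ { here → z≤n ; (there y∈p) → ⊥-elim (¬nep (_ , y∈p)) }
maximum (b ∷ p) (suc x , there x∈p) | no ¬nep = ⊥-elim (¬nep (x , x∈p))

Empty⇒∣p∣≡0 : ∀ {n} {p : Subset n} → Empty p → ∣ p ∣ ≡ 0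
Empty⇒∣p∣≡0 {n} empty = trans (cong ∣_∣ (Empty-unique empty)) (∣⊥∣≡0 n)

∣p∣≢0⇒Nonempty : ∀ {n} (p : Subset n) → ∣ p ∣ ≢ 0 → Nonempty p
∣p∣≢0⇒Nonempty p ∣p∣≢0 with nonempty? p
... | yes ne    = ne
... | no  empty = ⊥-elim (∣p∣≢0 (Empty⇒∣p∣≡0 empty))

∣p∣≤1 : ∀ {n} (p : Subset n) → (∀ {x} → x ∈ p → toℕ x ≡ 0) → ∣ p ∣ ≤ 1
∣p∣≤1 []      _         = z≤n
∣p∣≤1 (b ∷ p) only-zero with Empty⇒∣p∣≡0 {p = p} (λ (_ , x∈p) → ℕ.0≢1+n (sym (only-zero (there x∈p))))
∣p∣≤1 (outside ∷ p) _ | ∣p∣≡0 = ℕ.≤-trans (ℕ.≤-reflexive ∣p∣≡0) z≤n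
∣p∣≤1 (inside  ∷ p) _ | ∣p∣≡0 = s≤s (ℕ.≤-reflexive ∣p∣≡0)

∣p─q∣+∣q∣≡∣p∣ : ∀ {n} (p q : Subset n) → q ⊆ p → ∣ p ─ q ∣ + ∣ q ∣ ≡ ∣ p ∣
∣p─q∣+∣q∣≡∣p∣ []          []          _   = refl
∣p─q∣+∣q∣≡∣p∣ (true  ∷ p) (true  ∷ q) q⊆p =
  trans (ℕ.+-suc ∣ p ─ q ∣ ∣ q ∣) (cong suc (∣p─q∣+∣q∣≡∣p∣ p q (drop-there ∘ q⊆p ∘ there)))
∣p─q∣+∣q∣≡∣p∣ (true  ∷ p) (false ∷ q) q⊆p = cong suc (∣p─q∣+∣q∣≡∣p∣ p q (drop-there ∘ q⊆p ∘ there))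
∣p─q∣+∣q∣≡∣p∣ (false ∷ p) (false ∷ q) q⊆p = ∣p─q∣+∣q∣≡∣p∣ p q (drop-there ∘ q⊆p ∘ there)
∣p─q∣+∣q∣≡∣p∣ (false ∷ p) (true  ∷ q) q⊆p with q⊆p here
... | ()

⊆⇒≡⊎∣∣< : ∀ {n} (p q : Subset n) → p ⊆ q → p ≡ q ⊎ ∣ p ∣ < ∣ q ∣
⊆⇒≡⊎∣∣< []          []          _   = inj₁ refl
⊆⇒≡⊎∣∣< (true  ∷ p) (false ∷ q) p⊆q with p⊆q here
... | ()
⊆⇒≡⊎∣∣< (true  ∷ p) (true  ∷ q) p⊆q with ⊆⇒≡⊎∣∣< p q (drop-there ∘ p⊆q ∘ there)
... | inj₁ refl = inj₁ refl
... | inj₂ lt   = inj₂ (s≤s lt)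
⊆⇒≡⊎∣∣< (false ∷ p) (false ∷ q) p⊆q with ⊆⇒≡⊎∣∣< p q (drop-there ∘ p⊆q ∘ there)
... | inj₁ refl = inj₁ refl
... | inj₂ lt   = inj₂ lt
⊆⇒≡⊎∣∣< (false ∷ p) (true  ∷ q) p⊆q = inj₂ (s≤s (p⊆q⇒∣p∣≤∣q∣ (drop-there ∘ p⊆q ∘ there)))

∣⁅x⁆∪⁅y⁆∣≡2 : ∀ {n} {x y : Fin n} → x ≢ y → ∣ ⁅ x ⁆ ∪ ⁅ y ⁆ ∣ ≡ 2
∣⁅x⁆∪⁅y⁆∣≡2 {x = zero}  {zero}  x≢y = ⊥-elim (x≢y refl)
∣⁅x⁆∪⁅y⁆∣≡2 {x = zero}  {suc y} _   = trans (cong (suc ∘ ∣_∣) (∪-identityˡ ⁅ y ⁆)) (cong suc (∣⁅x⁆∣≡1 y))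
∣⁅x⁆∪⁅y⁆∣≡2 {x = suc x} {zero}  _   = trans (cong (suc ∘ ∣_∣) (∪-identityʳ ⁅ x ⁆)) (cong suc (∣⁅x⁆∣≡1 x))
∣⁅x⁆∪⁅y⁆∣≡2 {x = suc x} {suc y} x≢y = ∣⁅x⁆∪⁅y⁆∣≡2 (x≢y ∘ cong suc)

module Stabilisation {n} (F : Subset n → Subset n) (R : ℕ → Subset n)
                     (R-suc : ∀ m → R (suc m) ≡ F (R m)) (R-mono : ∀ m → R m ⊆ R (suc m)) where

  R-mono+ : ∀ j m → R m ⊆ R (j + m)
  R-mono+ zero    m = λ x∈ → x∈
  R-mono+ (suc j) m = R-mono (j + m) ∘ R-mono+ j m

  R-const : ∀ {i} → R i ≡ R (suc i) → ∀ j → R (j + i) ≡ R i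
  R-const     eq zero    = refl
  R-const {i} eq (suc j) = begin
    R (suc (j + i)) ≡⟨ R-suc (j + i) ⟩
    F (R (j + i))   ≡⟨ cong F (R-const eq j) ⟩
    F (R i)         ≡⟨ R-suc i ⟨
    R (suc i)       ≡⟨ eq ⟨
    R i             ∎
    where open ≡-Reasoning

  ⊆-stationary : ∀ {i} → R i ≡ R (suc i) → ∀ m → R m ⊆ R i
  ⊆-stationary {i} eq m with ℕ.≤-total m i
  ... | inj₁ m≤i = subst (λ t → R m ⊆ R t) (ℕ.m∸n+n≡m m≤i) (R-mono+ (i ∸ m) m)
  ... | inj₂ i≤m = subst (_⊆ R i) (sym Rm≡Ri) (λ x∈ → x∈)
    where
    Rm≡Ri : R m ≡ R i
    Rm≡Ri = trans (cong R (sym (ℕ.m∸n+n≡m i≤m))) (R-const eq (m ∸ i))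

  stationary-or-growing : ∀ m → (∃ λ i → i ≤ m × R i ≡ R (suc i)) ⊎ m ≤ ∣ R m ∣
  stationary-or-growing zero    = inj₂ z≤n
  stationary-or-growing (suc m) with stationary-or-growing m
  ... | inj₁ (i , i≤m , eq) = inj₁ (i , ℕ.m≤n⇒m≤1+n i≤m , eq)
  ... | inj₂ m≤∣Rm∣ with ⊆⇒≡⊎∣∣< (R m) (R (suc m)) (R-mono m)
  ...   | inj₁ eq = inj₁ (m , ℕ.n≤1+n m , eq)
  ...   | inj₂ lt = inj₂ (ℕ.≤-<-trans m≤∣Rm∣ lt)

  Rₘ⊆Rₙ : ∀ m → R m ⊆ R n
  Rₘ⊆Rₙ m with stationary-or-growing n
  ... | inj₁ (i , i≤n , eq) =
    subst (R m ⊆_) (trans (sym (R-const eq (n ∸ i))) (cong R (ℕ.m∸n+n≡m i≤n))) (⊆-stationary eq m)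
  ... | inj₂ n≤∣Rn∣ = subst (R m ⊆_) (sym (∣p∣≡n⇒p≡⊤ (ℕ.≤-antisym (∣p∣≤n (R n)) n≤∣Rn∣))) (λ _ → ∈⊤)

mexFrom-≡ : ∀ i f xs r → i ≤ r → r ≤ i + f →
            (∀ j → i ≤ j → j < r → j ∈ˡ xs) → ¬ r ∈ˡ xs → mexFrom i f xs ≡ r
mexFrom-≡ i zero    xs r i≤r r≤i+0   _     _  = ℕ.≤-antisym i≤r (subst (r ≤_) (ℕ.+-identityʳ i) r≤i+0)
mexFrom-≡ i (suc f) xs r i≤r r≤i+1+f below r∉ with memᵇ i xs in eq | ℕ.m≤n⇒m<n∨m≡n i≤r
... | false | inj₁ i<r  = ⊥-elim (subst T eq (memᵇ-complete i xs (below i ℕ.≤-refl i<r)))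
... | false | inj₂ refl = refl
... | true  | inj₂ refl = ⊥-elim (r∉ (memᵇ-sound r xs (subst T (sym eq) _)))
... | true  | inj₁ i<r  =
  mexFrom-≡ (suc i) f xs r i<r (subst (r ≤_) (ℕ.+-suc i f) r≤i+1+f) (λ j → below j ∘ ℕ.<⇒≤) r∉

mex-≡ : ∀ xs r → r ≤ 2 → (∀ j → j < r → j ∈ˡ xs) → ¬ r ∈ˡ xs → mex xs ≡ r
mex-≡ xs r r≤2 below = mexFrom-≡ 0 (suc (length xs)) xs r z≤n (fuel r r≤2 below) (λ j _ → below j)
  where
  fuel : ∀ r → r ≤ 2 → (∀ j → j < r → j ∈ˡ xs) → r ≤ suc (length xs)
  fuel 0 _ _ = z≤n
  fuel 1 _ _ = s≤s z≤n
  fuel 2 _ below with below 0 (s≤s z≤n)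
  ... | here  _ = s≤s (s≤s z≤n)
  ... | there _ = s≤s (s≤s z≤n)
  fuel (suc (suc (suc _))) (s≤s (s≤s ())) _

[m%n+o]%n≡[m+o]%n : ∀ m o n .{{_ : NonZero n}} → (m % n + o) % n ≡ (m + o) % n
[m%n+o]%n≡[m+o]%n m o n = begin
  (m % n + o) % n         ≡⟨ %-distribˡ-+ (m % n) o n ⟩
  (m % n % n + o % n) % n ≡⟨ cong (λ t → (t + o % n) % n) (m%n%n≡m%n m n) ⟩
  (m % n + o % n) % n     ≡⟨ %-distribˡ-+ m o n ⟨
  (m + o) % n             ∎
  where open ≡-Reasoning

-- Adding c * (n - 1) to both sides turns the shift by c into a shift by c * n.
%-+-cancelʳ : ∀ x y c n .{{_ : NonZero n}} → (x + c) % n ≡ (y + c) % n → x % n ≡ y % n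
%-+-cancelʳ x y c n@(suc n-1) eq = begin
  x % n                       ≡⟨ undo-shift x ⟨
  (x + c + c * n-1) % n       ≡⟨ [m%n+o]%n≡[m+o]%n (x + c) (c * n-1) n ⟨
  ((x + c) % n + c * n-1) % n ≡⟨ cong (λ t → (t + c * n-1) % n) eq ⟩
  ((y + c) % n + c * n-1) % n ≡⟨ [m%n+o]%n≡[m+o]%n (y + c) (c * n-1) n ⟩
  (y + c + c * n-1) % n       ≡⟨ undo-shift y ⟩
  y % n                       ∎
  where
  open ≡-Reasoning
  undo-shift : ∀ z → (z + c + c * n-1) % n ≡ z % n
  undo-shift z = trans (cong (_% n) (trans (ℕ.+-assoc z c _) (cong (z +_) (sym (ℕ.*-suc c n-1)))))
                       ([m+kn]%n≡m%n z c n)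

L124-%3≢0 : ∀ {c} → T (L124 c) → c % 3 ≢ 0
L124-%3≢0 {1} _ ()
L124-%3≢0 {2} _ ()
L124-%3≢0 {4} _ ()
L124-%3≢0 {0} ()
L124-%3≢0 {3} ()
L124-%3≢0 {suc (suc (suc (suc (suc _))))} ()

%3≡2⇒2≤ : ∀ {n} → n % 3 ≡ 2 → 2 ≤ n
%3≡2⇒2≤ {0}           ()
%3≡2⇒2≤ {1}           ()
%3≡2⇒2≤ {suc (suc _)} _ = s≤s (s≤s z≤n)

-- Connectivity and the game on a graph with symmetric adjacency

module Connectivity (G : Graph) (adj-sym : ∀ {u v} → T (adj G u v) → T (adj G v u)) where

  Vertex : Set
  Vertex = Fin (size G)

  data Walk (S : Subset (size G)) (x : Vertex) : Vertex → Set where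
    nil  : Walk S x x
    snoc : ∀ {y z} → Walk S x y → T (adj G y z) → z ∈ S → Walk S x z

  Connected : Subset (size G) → Set
  Connected S = ∀ {x y} → x ∈ S → y ∈ S → Walk S x y

  module _ {S : Subset (size G)} where

    walk-end∈ : ∀ {x y} → x ∈ S → Walk S x y → y ∈ S
    walk-end∈ x∈S nil            = x∈S
    walk-end∈ x∈S (snoc _ _ z∈S) = z∈S

    _++_ : ∀ {x y z} → Walk S x y → Walk S y z → Walk S x z
    p ++ nil          = p
    p ++ snoc q a z∈S = snoc (p ++ q) a z∈S

    reverse : ∀ {x y} → x ∈ S → Walk S x y → Walk S y x
    reverse x∈S nil            = nil
    reverse x∈S (snoc p a z∈S) = snoc nil (adj-sym a) (walk-end∈ x∈S p) ++ reverse x∈S p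

    first-step : ∀ {x y} → Walk S x y → x ≢ y → ∃ λ z → z ∈ S × T (adj G x z)
    first-step nil                    x≢x = ⊥-elim (x≢x refl)
    first-step {x} (snoc {y} p a z∈S) x≢z with x ≟ᶠ y
    ... | yes refl = _ , z∈S , a
    ... | no  x≢y  = first-step p x≢y

  module Reach (S : Subset (size G)) (u : Vertex) where

    R : ℕ → Subset (size G)
    R = reach G S u

    step : Subset (size G) → Subset (size G)
    step P = tabulate (λ w → lookup P w ∨ (lookup S w ∧ anyᵇ (λ v → lookup P v ∧ adj G v w)))

    R-mono : ∀ m → R m ⊆ R (suc m)
    R-mono m w∈ = ∈-tabulate⁺ _ (Equivalence.from T-∨ (inj₁ (∈⇒T-lookup w∈)))

    reach-sound : ∀ m {w} → w ∈ R m → w ∈ S × Walk S u w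
    reach-sound zero {w} w∈ with Equivalence.to T-∧ (∈-tabulate⁻ _ w∈)
    ... | w≡u , w∈S with toℕ-injective (≡ᵇ⇒≡ (toℕ w) (toℕ u) w≡u)
    ...   | refl = T-lookup⇒∈ S w w∈S , nil
    reach-sound (suc m) {w} w∈ with Equivalence.to T-∨ (∈-tabulate⁻ _ w∈)
    ... | inj₁ w∈R = reach-sound m (T-lookup⇒∈ (R m) w w∈R)
    ... | inj₂ t with Equivalence.to T-∧ t
    ...   | w∈S , next-to-R with anyᵇ-sound _ next-to-R
    ...     | v , t′ with Equivalence.to T-∧ t′
    ...       | v∈R , a =
      T-lookup⇒∈ S w w∈S , snoc (proj₂ (reach-sound m (T-lookup⇒∈ (R m) v v∈R))) a (T-lookup⇒∈ S w w∈S)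

    reach-complete : u ∈ S → ∀ {w} → Walk S u w → ∃ λ m → w ∈ R m
    reach-complete u∈S nil =
      0 , ∈-tabulate⁺ _ (Equivalence.from T-∧ (≡⇒≡ᵇ (toℕ u) (toℕ u) refl , ∈⇒T-lookup u∈S))
    reach-complete u∈S (snoc {y} p a w∈S) with reach-complete u∈S p
    ... | m , y∈R = suc m , ∈-tabulate⁺ _ (Equivalence.from T-∨ (inj₂ (Equivalence.from T-∧
                      (∈⇒T-lookup w∈S , anyᵇ-complete _ y (Equivalence.from T-∧ (∈⇒T-lookup y∈R , a))))))

    open Stabilisation step R (λ _ → refl) R-mono public using (Rₘ⊆Rₙ)

  connectedᵇ-sound : ∀ S → T (connectedᵇ G S) → Connected S
  connectedᵇ-sound S t {x} {y} x∈S y∈S with firstElem S in eq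
  ... | nothing = ⊥-elim (firstElem-nothing S eq (x , x∈S))
  ... | just u  = reverse (firstElem-just S eq) (walk-to x∈S) ++ walk-to y∈S
    where
    open Reach S u
    walk-to : ∀ {z} → z ∈ S → Walk S u z
    walk-to z∈S = proj₂ (reach-sound (size G) (subsetᵇ-sound S (R (size G)) t z∈S))

  connectedᵇ-complete : ∀ S → Connected S → T (connectedᵇ G S)
  connectedᵇ-complete S conn with firstElem S in eq
  ... | nothing = _
  ... | just u  = subsetᵇ-complete S (R (size G)) λ z∈S →
    let m , z∈Rm = reach-complete u∈S (conn u∈S z∈S) in Rₘ⊆Rₙ m z∈Rm
    where
    open Reach S u
    u∈S : u ∈ S
    u∈S = firstElem-just S eq

  IsLeaf : Subset (size G) → Vertex → Set
  IsLeaf S v = ∀ {y z} → y ∈ S → z ∈ S → T (adj G v y) → T (adj G v z) → y ≡ z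

  -- A walk that enters the leaf v must leave through its only neighbour, where it already was.
  module _ {S : Subset (size G)} {v : Vertex} (leaf : IsLeaf S v) where

    walk-avoiding-leaf : ∀ {x y} → x ∈ S → x ≢ v → Walk S x y →
                         (y ≢ v → Walk (S - v) x y) ×
                         (y ≡ v → ∃ λ p → p ∈ S × T (adj G v p) × Walk (S - v) x p)
    walk-avoiding-leaf x∈S x≢v nil = (λ _ → nil) , (λ x≡v → ⊥-elim (x≢v x≡v))
    walk-avoiding-leaf x∈S x≢v (snoc {y} {z} p a z∈S)
      with walk-avoiding-leaf x∈S x≢v p | y ≟ᶠ v | z ≟ᶠ v
    ... | _     , at-v | yes refl | no z≢v =
      let q , q∈S , v~q , walk = at-v refl in
      (λ _ → subst (Walk (S - v) _) (leaf q∈S z∈S v~q a) walk) , (λ z≡v → ⊥-elim (z≢v z≡v))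
    ... | avoid , _    | no y≢v   | no z≢v =
      (λ _ → snoc (avoid y≢v) a (x∈p∧x≢y⇒x∈p-y z∈S z≢v)) , (λ z≡v → ⊥-elim (z≢v z≡v))
    ... | _     , at-v | yes refl | yes refl = (λ z≢v → ⊥-elim (z≢v refl)) , at-v
    ... | avoid , _    | no y≢v   | yes refl =
      (λ z≢v → ⊥-elim (z≢v refl)) , (λ _ → y , walk-end∈ x∈S p , adj-sym a , avoid y≢v)

  leaf-removal : ∀ {S v} → Connected S → IsLeaf S v → Connected (S - v)
  leaf-removal {S} conn leaf x∈ y∈ =
    let x∈S , x≢v = x∈p-y⁻ S x∈
        y∈S , y≢v = x∈p-y⁻ S y∈
    in proj₁ (walk-avoiding-leaf leaf x∈S x≢v (conn x∈S y∈S)) y≢v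

  has-neighbour : ∀ {S v} → Connected S → 2 ≤ ∣ S ∣ → v ∈ S → ∃ λ w → w ∈ S × T (adj G v w)
  has-neighbour {S} {v} conn 2≤∣S∣ v∈S =
    let y , y∈   = ∣p∣≢0⇒Nonempty (S - v) ∣S-v∣≢0
        y∈S , y≢v = x∈p-y⁻ S y∈
    in first-step (conn v∈S y∈S) (y≢v ∘ sym)
    where
    ∣S-v∣≢0 : ∣ S - v ∣ ≢ 0
    ∣S-v∣≢0 ∣S-v∣≡0 = ℕ.<-irrefl (sym ∣S∣≡1) 2≤∣S∣
      where
      ∣S∣≡1 : ∣ S ∣ ≡ 1
      ∣S∣≡1 = trans (sym (∣p─q∣+∣q∣≡∣p∣ S ⁅ v ⁆ (⁅x⁆⊆p v∈S))) (cong₂ _+_ ∣S-v∣≡0 (∣⁅x⁆∣≡1 v))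

  ⁅v⁆-connected : ∀ v → Connected ⁅ v ⁆
  ⁅v⁆-connected v x∈ y∈ with x∈⁅y⁆⇒x≡y v x∈ | x∈⁅y⁆⇒x≡y v y∈
  ... | refl | refl = nil

  edge-connected : ∀ {u w} → T (adj G u w) → Connected (⁅ u ⁆ ∪ ⁅ w ⁆)
  edge-connected {u} {w} a x∈ y∈ with x∈p∪q⁻ ⁅ u ⁆ ⁅ w ⁆ x∈ | x∈p∪q⁻ ⁅ u ⁆ ⁅ w ⁆ y∈
  ... | inj₁ x∈u | inj₁ y∈u rewrite x∈⁅y⁆⇒x≡y u x∈u | x∈⁅y⁆⇒x≡y u y∈u = nil
  ... | inj₂ x∈w | inj₂ y∈w rewrite x∈⁅y⁆⇒x≡y w x∈w | x∈⁅y⁆⇒x≡y w y∈w = nil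
  ... | inj₁ x∈u | inj₂ y∈w rewrite x∈⁅y⁆⇒x≡y u x∈u | x∈⁅y⁆⇒x≡y w y∈w = snoc nil a y∈
  ... | inj₂ x∈w | inj₁ y∈u rewrite x∈⁅y⁆⇒x≡y w x∈w | x∈⁅y⁆⇒x≡y u y∈u = snoc nil (adj-sym a) y∈

  Legal : (ℕ → Bool) → Subset (size G) → Subset (size G) → Bool
  Legal L S H = subsetᵇ H S ∧ L ∣ H ∣ ∧ connectedᵇ G H ∧ connectedᵇ G (S ─ H)

  moves-sound : ∀ {L S H} → H ∈ˡ moves L G S → H ⊆ S × T (L ∣ H ∣) × Connected (S ─ H)
  moves-sound {L} {S} {H} H∈
    with Equivalence.to T-∧ (proj₂ (∈-filter⁻ (T? ∘ Legal L S) {xs = allSubsets (size G)} H∈))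
  ... | H⊆S , t with Equivalence.to T-∧ t
  ...   | ∣H∣∈L , t′ =
    subsetᵇ-sound H S H⊆S , ∣H∣∈L , connectedᵇ-sound (S ─ H) (proj₂ (Equivalence.to T-∧ t′))

  moves-complete : ∀ {L S H} → H ⊆ S → T (L ∣ H ∣) → Connected H → Connected (S ─ H) → H ∈ˡ moves L G S
  moves-complete {L} {S} {H} H⊆S ∣H∣∈L H-conn rest-conn =
    ∈-filter⁺ (T? ∘ Legal L S) (∈-allSubsets (size G) H)
      (Equivalence.from T-∧ (subsetᵇ-complete H S H⊆S , Equivalence.from T-∧ (∣H∣∈L ,
        Equivalence.from T-∧ (connectedᵇ-complete H H-conn , connectedᵇ-complete (S ─ H) rest-conn))))

  leaf-move : ∀ {L S v} → T (L 1) → Connected S → v ∈ S → IsLeaf S v → ⁅ v ⁆ ∈ˡ moves L G S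
  leaf-move {L} {S} {v} 1∈L conn v∈S leaf =
    moves-complete {L} (⁅x⁆⊆p v∈S) (subst (T ∘ L) (sym (∣⁅x⁆∣≡1 v)) 1∈L)
                   (⁅v⁆-connected v) (leaf-removal conn leaf)

  record PendantEdge (S : Subset (size G)) : Set where
    field
      tip base          : Vertex
      tip∈S             : tip ∈ S
      base∈S            : base ∈ S
      tip≢base          : tip ≢ base
      tip-base-adjacent : T (adj G tip base)
      tip-leaf          : IsLeaf S tip
      base-leaf         : IsLeaf (S - tip) base

    edge : Subset (size G)
    edge = ⁅ tip ⁆ ∪ ⁅ base ⁆

    ∣edge∣≡2 : ∣ edge ∣ ≡ 2
    ∣edge∣≡2 = ∣⁅x⁆∪⁅y⁆∣≡2 tip≢base

    edge-move : ∀ {L} → T (L 2) → Connected S → edge ∈ˡ moves L G S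
    edge-move {L} 2∈L conn =
      moves-complete {L} edge⊆S (subst (T ∘ L) (sym ∣edge∣≡2) 2∈L) (edge-connected tip-base-adjacent)
        (subst Connected (p─q─r≡p─q∪r S ⁅ tip ⁆ ⁅ base ⁆)
               (leaf-removal (leaf-removal conn tip-leaf) base-leaf))
      where
      edge⊆S : edge ⊆ S
      edge⊆S x∈ with x∈p∪q⁻ ⁅ tip ⁆ ⁅ base ⁆ x∈
      ... | inj₁ x∈tip  = ⁅x⁆⊆p tip∈S x∈tip
      ... | inj₂ x∈base = ⁅x⁆⊆p base∈S x∈base

  module GrundyMod3
    (leaf-exists    : ∀ {S} → Connected S → Nonempty S → ∃ λ v → v ∈ S × IsLeaf S v)
    (pendant-exists : ∀ {S} → Connected S → ∣ S ∣ % 3 ≡ 2 → PendantEdge S) where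

    grundyFuel-≡ : ∀ f S → Connected S → ∣ S ∣ ≤ f → grundyFuel L124 G f S ≡ ∣ S ∣ % 3
    grundyFuel-≡ zero    S _    ∣S∣≤0 rewrite ℕ.n≤0⇒n≡0 ∣S∣≤0 = refl
    grundyFuel-≡ (suc f) S conn ∣S∣≤1+f =
      mex-≡ values (∣ S ∣ % 3) (ℕ.≤-pred (m%n<n ∣ S ∣ 3)) (reached (∣ S ∣ % 3) refl) unreached
      where
      value : Subset (size G) → ℕ
      value H = grundyFuel L124 G f (S ─ H)

      values : List ℕ
      values = map value (moves L124 G S)

      module _ {H} (H∈ : H ∈ˡ moves L124 G S) where

        ∣H∣∈L124 : T (L124 ∣ H ∣)
        ∣H∣∈L124 = proj₁ (proj₂ (moves-sound {L124} H∈))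

        ∣S─H∣+∣H∣≡∣S∣ : ∣ S ─ H ∣ + ∣ H ∣ ≡ ∣ S ∣
        ∣S─H∣+∣H∣≡∣S∣ = ∣p─q∣+∣q∣≡∣p∣ S H (proj₁ (moves-sound {L124} H∈))

        ∣S─H∣<∣S∣ : ∣ S ─ H ∣ < ∣ S ∣
        ∣S─H∣<∣S∣ = subst (∣ S ─ H ∣ <_) ∣S─H∣+∣H∣≡∣S∣
                      (ℕ.m<m+n (∣ S ─ H ∣) (ℕ.n≢0⇒n>0 (L124-%3≢0 {∣ H ∣} ∣H∣∈L124 ∘ cong (_% 3))))

        value-≡ : value H ≡ ∣ S ─ H ∣ % 3
        value-≡ = grundyFuel-≡ f (S ─ H) (proj₂ (proj₂ (moves-sound {L124} H∈)))
                               (ℕ.≤-pred (ℕ.≤-trans ∣S─H∣<∣S∣ ∣S∣≤1+f))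

        reaches : ∀ t → t < 3 → (t + ∣ H ∣) % 3 ≡ ∣ S ∣ % 3 → t ∈ˡ values
        reaches t t<3 eq = subst (_∈ˡ values) value≡t (∈-map⁺ value H∈)
          where
          value≡t : value H ≡ t
          value≡t = begin
            value H       ≡⟨ value-≡ ⟩
            ∣ S ─ H ∣ % 3 ≡⟨ %-+-cancelʳ (∣ S ─ H ∣) t (∣ H ∣) 3 (trans (cong (_% 3) ∣S─H∣+∣H∣≡∣S∣) (sym eq)) ⟩
            t % 3         ≡⟨ m<n⇒m%n≡m t<3 ⟩
            t             ∎
            where open ≡-Reasoning

      unreached : ¬ (∣ S ∣ % 3) ∈ˡ values
      unreached r∈ with ∈-map⁻ value r∈
      ... | H , H∈ , r≡value =
        L124-%3≢0 {∣ H ∣} (∣H∣∈L124 H∈) (%-+-cancelʳ (∣ H ∣) 0 (∣ S ─ H ∣) 3 (begin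
          (∣ H ∣ + ∣ S ─ H ∣) % 3 ≡⟨ cong (_% 3) (trans (ℕ.+-comm ∣ H ∣ _) (∣S─H∣+∣H∣≡∣S∣ H∈)) ⟩
          ∣ S ∣ % 3               ≡⟨ trans r≡value (value-≡ H∈) ⟩
          ∣ S ─ H ∣ % 3           ∎))
        where open ≡-Reasoning

      nonempty : ∀ {r} → ∣ S ∣ % 3 ≡ suc r → Nonempty S
      nonempty r≡ = ∣p∣≢0⇒Nonempty S (λ ∣S∣≡0 → ℕ.0≢1+n (trans (sym (cong (_% 3) ∣S∣≡0)) r≡))

      by-leaf : ∀ t → t < 3 → (t + 1) % 3 ≡ ∣ S ∣ % 3 → Nonempty S → t ∈ˡ values
      by-leaf t t<3 eq ne =
        let v , v∈S , leaf = leaf-exists conn ne in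
        reaches (leaf-move {L124} _ conn v∈S leaf) t t<3 (trans (cong (λ c → (t + c) % 3) (∣⁅x⁆∣≡1 v)) eq)

      by-pendant : ∣ S ∣ % 3 ≡ 2 → 0 ∈ˡ values
      by-pendant r≡ = reaches (edge-move {L124} _ conn) 0 (s≤s z≤n) (trans (cong (_% 3) ∣edge∣≡2) (sym r≡))
        where open PendantEdge (pendant-exists conn r≡)

      reached : ∀ r → ∣ S ∣ % 3 ≡ r → ∀ j → j < r → j ∈ˡ values
      reached 1 r≡ 0 _ = by-leaf 0 (s≤s z≤n) (sym r≡) (nonempty r≡)
      reached 2 r≡ 0 _ = by-pendant r≡
      reached 2 r≡ 1 _ = by-leaf 1 (s≤s (s≤s z≤n)) (sym r≡) (nonempty r≡)
      reached 1 _  (suc _)       (s≤s ())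
      reached 2 _  (suc (suc _)) (s≤s (s≤s ()))
      reached (suc (suc (suc _))) r≡ _ _ with subst (_< 3) r≡ (m%n<n ∣ S ∣ 3)
      ... | s≤s (s≤s (s≤s ()))

    𝒢≡size%3 : Connected ⊤ → 𝒢 G ≡ size G % 3
    𝒢≡size%3 conn = trans (grundyFuel-≡ (size G) ⊤ conn (ℕ.≤-reflexive (∣⊤∣≡n (size G))))
                          (cong (_% 3) (∣⊤∣≡n (size G)))

-- Trees given by a parent function

ParentEdge : (ℕ → ℕ) → ℕ → ℕ → Set
ParentEdge parent a b = (0 < a × b ≡ parent a) ⊎ (0 < b × a ≡ parent b)

module ParentTree (G : Graph) (parent : ℕ → ℕ) (parent-< : ∀ {a} → 0 < a → parent a < a)
                  (adj⇔ : ∀ {u v} → T (adj G u v) ⇔ ParentEdge parent (toℕ u) (toℕ v)) where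

  adj-sym : ∀ {u v} → T (adj G u v) → T (adj G v u)
  adj-sym a = Equivalence.from adj⇔ (swap (Equivalence.to adj⇔ a))

  open Connectivity G adj-sym public

  child≢parent : ∀ {c w : Vertex} → 0 < toℕ c → toℕ w ≡ parent (toℕ c) → c ≢ w
  child≢parent 0<c w≡ c≡w = ℕ.<-irrefl (trans (sym w≡) (cong toℕ (sym c≡w))) (parent-< 0<c)

  walk-from-root : ∀ a {r} → toℕ r ≡ 0 → ∀ x → toℕ x ≤ a → Walk ⊤ r x
  walk-from-root a r≡0 x x≤a with toℕ x ℕ.≟ 0
  ... | yes x≡0 = subst (Walk ⊤ _) (toℕ-injective (trans r≡0 (sym x≡0))) nil
  walk-from-root zero    r≡0 x x≤0   | no x≢0 = ⊥-elim (x≢0 (ℕ.n≤0⇒n≡0 x≤0))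
  walk-from-root (suc a) r≡0 x x≤1+a | no x≢0 =
    snoc (walk-from-root a r≡0 up (subst (_≤ a) (sym up≡) (s≤s⁻¹ (ℕ.≤-trans parent<x x≤1+a))))
         (Equivalence.from adj⇔ (inj₂ (ℕ.n≢0⇒n>0 x≢0 , up≡)))
         ∈⊤
    where
    parent<x : parent (toℕ x) < toℕ x
    parent<x = parent-< (ℕ.n≢0⇒n>0 x≢0)
    up : Vertex
    up = fromℕ< (ℕ.<-trans parent<x (toℕ<n x))
    up≡ : toℕ up ≡ parent (toℕ x)
    up≡ = toℕ-fromℕ< _

  ⊤-connected : Connected ⊤
  ⊤-connected {x} {y} _ _ = reverse ∈⊤ (from-root x) ++ from-root y
    where
    root : Vertex
    root = fromℕ< (ℕ.≤-trans (s≤s z≤n) (toℕ<n x))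
    from-root : ∀ z → Walk ⊤ root z
    from-root z = walk-from-root (toℕ z) (toℕ-fromℕ< _) z ℕ.≤-refl

  leaf-by : ∀ {S v} a → (∀ {y} → y ∈ S → T (adj G v y) → toℕ y ≡ a) → IsLeaf S v
  leaf-by a nb y∈ z∈ v~y v~z = toℕ-injective (trans (nb y∈ v~y) (sym (nb z∈ v~z)))

  neighbour-of-max : ∀ {S m y} → (∀ {x} → x ∈ S → toℕ x ≤ toℕ m) → y ∈ S → T (adj G m y) →
                     0 < toℕ m × toℕ y ≡ parent (toℕ m)
  neighbour-of-max m-max y∈S m~y with Equivalence.to adj⇔ m~y
  ... | inj₁ edge       = edge
  ... | inj₂ (0<y , m≡) = ⊥-elim (ℕ.<⇒≱ (subst (_< _) (sym m≡) (parent-< 0<y)) (m-max y∈S))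

  max-leaf : ∀ {S m} → (∀ {x} → x ∈ S → toℕ x ≤ toℕ m) → IsLeaf S m
  max-leaf {m = m} m-max = leaf-by (parent (toℕ m)) (λ y∈ m~y → proj₂ (neighbour-of-max m-max y∈ m~y))

  max-leaf-exists : ∀ {S} → Nonempty S → ∃ λ m → m ∈ S × IsLeaf S m
  max-leaf-exists {S} ne = let m , m∈S , m-max = maximum S ne in m , m∈S , max-leaf m-max

  childless-leaf : ∀ {S v} → (∀ b → parent b ≢ toℕ v) → IsLeaf S v
  childless-leaf {v = v} childless = leaf-by (parent (toℕ v)) λ _ v~y → case Equivalence.to adj⇔ v~y of λ where
    (inj₁ (_ , y≡)) → y≡
    (inj₂ (_ , v≡)) → ⊥-elim (childless _ (sym v≡))

  parent-leaf : (∀ {a b} → 0 < parent a → parent a ≡ parent b → a ≡ b) →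
                ∀ {S c w} → toℕ w ≡ parent (toℕ c) → 0 < toℕ w → IsLeaf (S - c) w
  parent-leaf single-child {S} w≡ 0<w = leaf-by (parent (toℕ _)) λ y∈ w~y → case Equivalence.to adj⇔ w~y of λ where
    (inj₁ (_ , y≡))  → y≡
    (inj₂ (_ , w≡′)) → ⊥-elim (proj₂ (x∈p-y⁻ S y∈)
                         (toℕ-injective (single-child (subst (0 <_) w≡′ 0<w) (trans (sym w≡′) w≡))))

  pendant-at : ∀ {S c w} → c ∈ S → w ∈ S → 0 < toℕ c → toℕ w ≡ parent (toℕ c) →
               IsLeaf S c → IsLeaf (S - c) w → PendantEdge S
  pendant-at c∈S w∈S 0<c w≡ c-leaf w-leaf = record
    { tip               = _
    ; base              = _
    ; tip∈S             = c∈S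
    ; base∈S            = w∈S
    ; tip≢base          = child≢parent 0<c w≡
    ; tip-base-adjacent = Equivalence.from adj⇔ (inj₁ (0<c , w≡))
    ; tip-leaf          = c-leaf
    ; base-leaf         = w-leaf
    }

-- The spider S_{2,2,k}

adjStarℕ-sym : ∀ ls a b → adjStarℕ ls a b ≡ adjStarℕ ls b a
adjStarℕ-sym ls zero    zero    = refl
adjStarℕ-sym ls zero    (suc b) with locate ls 0 b
... | just _  = refl
... | nothing = refl
adjStarℕ-sym ls (suc a) zero    with locate ls 0 a
... | just _  = refl
... | nothing = refl
adjStarℕ-sym ls (suc a) (suc b) with locate ls 0 a | locate ls 0 b
... | just (j , p) | just (j′ , q) = cong₂ _∧_ (≡ᵇ-comm j j′) (∨-comm (suc p ≡ᵇ q) (suc q ≡ᵇ p))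
... | just _       | nothing       = refl
... | nothing      | just _        = refl
... | nothing      | nothing       = refl

module Spider₂₂ (k : ℕ) where

  arms : List ℕ
  arms = 2 ∷ 2 ∷ k ∷ []

  G : Graph
  G = subdividedStar arms

  -- Vertex a + 1 hangs from a, except the first vertices 1, 3 and 5 of the arms, which hang
  -- from the centre 0.
  parent : ℕ → ℕ
  parent 1       = 0
  parent 3       = 0
  parent 5       = 0
  parent zero    = 0
  parent (suc a) = a

  parent-cases : ∀ a → parent a ≡ 0 ⊎ suc (parent a) ≡ a
  parent-cases 0 = inj₁ refl
  parent-cases 1 = inj₁ refl
  parent-cases 2 = inj₂ refl
  parent-cases 3 = inj₁ refl
  parent-cases 4 = inj₂ refl
  parent-cases 5 = inj₁ refl
  parent-cases (suc (suc (suc (suc (suc (suc _)))))) = inj₂ refl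

  parent-< : ∀ {a} → 0 < a → parent a < a
  parent-< {a} 0<a with parent-cases a
  ... | inj₁ ≡0 = subst (_< a) (sym ≡0) 0<a
  ... | inj₂ ≡a = subst (parent a <_) ≡a (ℕ.n<1+n (parent a))

  single-child : ∀ {a b} → 0 < parent a → parent a ≡ parent b → a ≡ b
  single-child {a} {b} 0<pa pa≡pb with parent-cases a | parent-cases b
  ... | inj₁ ≡0 | _       = ⊥-elim (ℕ.<⇒≢ 0<pa (sym ≡0))
  ... | inj₂ _  | inj₁ ≡0 = ⊥-elim (ℕ.<⇒≢ 0<pa (sym (trans pa≡pb ≡0)))
  ... | inj₂ ≡a | inj₂ ≡b = trans (sym ≡a) (trans (cong suc pa≡pb) ≡b)

  childless : ∀ c → 0 < c → parent (suc c) ≡ 0 → ∀ b → parent b ≢ c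
  childless c 0<c next-starts-arm b pb≡c with parent-cases b
  ... | inj₁ pb≡0   = ℕ.<⇒≢ 0<c (trans (sym pb≡0) pb≡c)
  ... | inj₂ 1+pb≡b = ℕ.<⇒≢ 0<c (sym (begin
    c                       ≡⟨ pb≡c ⟨
    parent b                ≡⟨ cong parent 1+pb≡b ⟨
    parent (suc (parent b)) ≡⟨ cong (parent ∘ suc) pb≡c ⟩
    parent (suc c)          ≡⟨ next-starts-arm ⟩
    0                       ∎))
    where open ≡-Reasoning

  arm-start : ∀ {a} → 0 < a → parent a ≡ 0 → a ≡ 1 ⊎ a ≡ 3 ⊎ a ≡ 5
  arm-start {1} _ _ = inj₁ refl
  arm-start {3} _ _ = inj₂ (inj₁ refl)
  arm-start {5} _ _ = inj₂ (inj₂ refl)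
  arm-start {2} _ ()
  arm-start {4} _ ()
  arm-start {suc (suc (suc (suc (suc (suc _)))))} _ ()

  earlier-arm-start : ∀ {y m} → 0 < y → parent y ≡ 0 → parent m ≡ 0 → y < m → y ≡ 1 ⊎ (y ≡ 3 × m ≡ 5)
  earlier-arm-start 0<y py≡0 pm≡0 y<m with arm-start 0<y py≡0 | arm-start (ℕ.<-trans 0<y y<m) pm≡0
  ... | inj₁ y≡1         | _                = inj₁ y≡1
  ... | inj₂ (inj₁ refl) | inj₂ (inj₂ refl) = inj₂ (refl , refl)
  earlier-arm-start _ _ _ (s≤s ())                         | inj₂ (inj₁ refl) | inj₁ refl
  earlier-arm-start _ _ _ (s≤s (s≤s (s≤s ())))             | inj₂ (inj₁ refl) | inj₂ (inj₁ refl)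
  earlier-arm-start _ _ _ (s≤s ())                         | inj₂ (inj₂ refl) | inj₁ refl
  earlier-arm-start _ _ _ (s≤s (s≤s (s≤s ())))             | inj₂ (inj₂ refl) | inj₂ (inj₁ refl)
  earlier-arm-start _ _ _ (s≤s (s≤s (s≤s (s≤s (s≤s ()))))) | inj₂ (inj₂ refl) | inj₂ (inj₂ refl)

  -- Position a j p: locate puts the non-centre vertex suc a at (0-based) place p of arm j.
  data Position : ℕ → ℕ → ℕ → Set where
    arm₀ : ∀ {p} → p < 2 → Position p       0 p
    arm₁ : ∀ {p} → p < 2 → Position (2 + p) 1 p
    arm₂ : ∀ {p} → p < k → Position (4 + p) 2 p

  locate-position : ∀ a {j p} → locate arms 0 a ≡ just (j , p) → Position a j p
  locate-position 0 refl = arm₀ (s≤s z≤n)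
  locate-position 1 refl = arm₀ (s≤s (s≤s z≤n))
  locate-position 2 refl = arm₁ (s≤s z≤n)
  locate-position 3 refl = arm₁ (s≤s (s≤s z≤n))
  locate-position (suc (suc (suc (suc i)))) eq with i <ᵇ k in i<k
  locate-position (suc (suc (suc (suc i)))) refl | true = arm₂ (ℕ.<ᵇ⇒< i k (subst T (sym i<k) _))

  first-on-arm-parent : ∀ {b j} → Position b j 0 → parent (suc b) ≡ 0
  first-on-arm-parent (arm₀ _) = refl
  first-on-arm-parent (arm₁ _) = refl
  first-on-arm-parent (arm₂ _) = refl

  next-on-arm-parent : ∀ {a b j p} → Position a j p → Position b j (suc p) → parent (suc b) ≡ suc a
  next-on-arm-parent (arm₀ _) (arm₀ (s≤s (s≤s z≤n))) = refl
  next-on-arm-parent (arm₁ _) (arm₁ (s≤s (s≤s z≤n))) = refl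
  next-on-arm-parent (arm₂ _) (arm₂ _)               = refl

  centre-adjacent⇒ParentEdge : ∀ b → T (adjStarℕ arms 0 (suc b)) → ParentEdge parent 0 (suc b)
  centre-adjacent⇒ParentEdge b t with locate arms 0 b in eq
  ... | just (j , p) with ≡ᵇ⇒≡ p 0 t
  ...   | refl = inj₂ (s≤s z≤n , sym (first-on-arm-parent (locate-position b eq)))

  adjacent⇒ParentEdge : ∀ a b → T (adjStarℕ arms a b) → ParentEdge parent a b
  adjacent⇒ParentEdge zero    (suc b) t = centre-adjacent⇒ParentEdge b t
  adjacent⇒ParentEdge (suc a) zero    t =
    swap (centre-adjacent⇒ParentEdge a (subst T (adjStarℕ-sym arms (suc a) 0) t))
  adjacent⇒ParentEdge (suc a) (suc b) t with locate arms 0 a in eqa | locate arms 0 b in eqb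
  ... | just (j , p) | just (j′ , q) with Equivalence.to T-∧ t
  ...   | j≡j′ , consecutive with ≡ᵇ⇒≡ j j′ j≡j′ | Equivalence.to T-∨ consecutive
  ...     | refl | inj₁ p+1≡q with ≡ᵇ⇒≡ (suc p) q p+1≡q
  ...       | refl = inj₂ (s≤s z≤n , sym (next-on-arm-parent (locate-position a eqa) (locate-position b eqb)))
  adjacent⇒ParentEdge (suc a) (suc b) t | just (j , p) | just (j′ , q) | _ , _ | refl | inj₂ q+1≡p
    with ≡ᵇ⇒≡ (suc q) p q+1≡p
  ... | refl = inj₁ (s≤s z≤n , sym (next-on-arm-parent (locate-position b eqb) (locate-position a eqa)))

  on-arm₂ : ∀ {i} → 5 + i < size G → i < k
  on-arm₂ {i} (s≤s (s≤s (s≤s (s≤s (s≤s i<k+0))))) = subst (i <_) (ℕ.+-identityʳ k) i<k+0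

  adjacent-parent : ∀ a → 0 < a → a < size G → T (adjStarℕ arms a (parent a))
  adjacent-parent 1 _ _ = _
  adjacent-parent 2 _ _ = _
  adjacent-parent 3 _ _ = _
  adjacent-parent 4 _ _ = _
  adjacent-parent 5 _ lt rewrite <ᵇ-true (on-arm₂ lt) = _
  adjacent-parent (suc (suc (suc (suc (suc (suc j)))))) _ lt
    rewrite <ᵇ-true (on-arm₂ lt) | <ᵇ-true (ℕ.<-trans (ℕ.n<1+n j) (on-arm₂ lt)) =
    Equivalence.from T-∨ (inj₂ (≡⇒≡ᵇ j j refl))

  ParentEdge⇒adjacent : ∀ {a b} → a < size G → b < size G → ParentEdge parent a b → T (adjStarℕ arms a b)
  ParentEdge⇒adjacent {a}     a<n _   (inj₁ (0<a , refl)) = adjacent-parent a 0<a a<n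
  ParentEdge⇒adjacent {b = b} _   b<n (inj₂ (0<b , refl)) =
    subst T (adjStarℕ-sym arms b (parent b)) (adjacent-parent b 0<b b<n)

  adj⇔ : ∀ {u v} → T (adj G u v) ⇔ ParentEdge parent (toℕ u) (toℕ v)
  adj⇔ {u} {v} = mk⇔ (adjacent⇒ParentEdge (toℕ u) (toℕ v)) (ParentEdge⇒adjacent (toℕ<n u) (toℕ<n v))

  open ParentTree G parent parent-< adj⇔

  fork-size%3≢2 : ∀ (S : Subset (size G)) → # 0 ∈ S → # 1 ∈ S → # 2 ∉ S → # 3 ∈ S → # 4 ∉ S →
                  (∀ {x} → x ∈ S → toℕ x ≤ 5) → ∣ S ∣ % 3 ≢ 2
  fork-size%3≢2 (_ ∷ _ ∷ inside ∷ _) _ _ 2∉S _ _ _ = ⊥-elim (2∉S (there (there here)))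
  fork-size%3≢2 (_ ∷ _ ∷ outside ∷ _ ∷ inside ∷ _) _ _ _ _ 4∉S _ =
    ⊥-elim (4∉S (there (there (there (there here)))))
  fork-size%3≢2 (_ ∷ _ ∷ outside ∷ _ ∷ outside ∷ rest) here (there here) _ (there (there (there here))) _ ≤5 =
    size%3 ∣ rest ∣ (∣p∣≤1 rest λ x∈ → ℕ.n≤0⇒n≡0 (ℕ.+-cancelˡ-≤ 5 _ _ (≤5 (there (there (there (there (there x∈))))))))
    where
    size%3 : ∀ r → r ≤ 1 → (3 + r) % 3 ≢ 2
    size%3 0 _ ()
    size%3 1 _ ()
    size%3 (suc (suc _)) (s≤s ()) _

  module _ {S : Subset (size G)} {m w : Vertex} (m-max : ∀ {x} → x ∈ S → toℕ x ≤ toℕ m)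
           (w≡0 : toℕ w ≡ 0) (pm≡0 : parent (toℕ m) ≡ 0) where

    centre-neighbour : ∀ {y} → y ∈ S - m → T (adj G w y) → toℕ y ≡ 1 ⊎ (toℕ y ≡ 3 × toℕ m ≡ 5)
    centre-neighbour y∈ w~y with Equivalence.to adj⇔ w~y
    ... | inj₁ (0<w , _)    = ⊥-elim (ℕ.<⇒≢ 0<w (sym w≡0))
    ... | inj₂ (0<y , w≡py) =
      let y∈S , y≢m = x∈p-y⁻ S y∈ in
      earlier-arm-start 0<y (trans (sym w≡py) w≡0) pm≡0 (ℕ.≤∧≢⇒< (m-max y∈S) (y≢m ∘ toℕ-injective))

    ∈S-at : ∀ {y x} → y ∈ S - m → toℕ y ≡ toℕ x → x ∈ S
    ∈S-at y∈ y≡x = subst (_∈ S) (toℕ-injective y≡x) (proj₁ (x∈p-y⁻ S y∈))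

    centre-leaf : ¬ (# 1 ∈ S × # 3 ∈ S × toℕ m ≡ 5) → IsLeaf (S - m) w
    centre-leaf no-fork y∈ z∈ w~y w~z with centre-neighbour y∈ w~y | centre-neighbour z∈ w~z
    ... | inj₁ y≡1         | inj₁ z≡1         = toℕ-injective (trans y≡1 (sym z≡1))
    ... | inj₂ (y≡3 , _)   | inj₂ (z≡3 , _)   = toℕ-injective (trans y≡3 (sym z≡3))
    ... | inj₁ y≡1         | inj₂ (z≡3 , m≡5) = ⊥-elim (no-fork (∈S-at y∈ y≡1 , ∈S-at z∈ z≡3 , m≡5))
    ... | inj₂ (y≡3 , m≡5) | inj₁ z≡1         = ⊥-elim (no-fork (∈S-at z∈ z≡1 , ∈S-at y∈ y≡3 , m≡5))

  no-fork : ∀ {S : Subset (size G)} {m : Vertex} → ∣ S ∣ % 3 ≡ 2 → (∀ {x} → x ∈ S → toℕ x ≤ toℕ m) →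
            # 0 ∈ S → ¬ (# 1 ∈ S × # 2 ∈ S) → ¬ (# 3 ∈ S × # 4 ∈ S) → ¬ (# 1 ∈ S × # 3 ∈ S × toℕ m ≡ 5)
  no-fork {S} r≡2 m-max 0∈S ¬12 ¬34 (1∈S , 3∈S , m≡5) =
    fork-size%3≢2 S 0∈S 1∈S (λ 2∈S → ¬12 (1∈S , 2∈S)) 3∈S (λ 4∈S → ¬34 (3∈S , 4∈S))
                  (λ x∈ → subst (_ ≤_) m≡5 (m-max x∈)) r≡2

  pendant-near-max : ∀ {S m w} → ∣ S ∣ % 3 ≡ 2 → m ∈ S → (∀ {x} → x ∈ S → toℕ x ≤ toℕ m) →
                     w ∈ S → 0 < toℕ m → toℕ w ≡ parent (toℕ m) → PendantEdge S
  pendant-near-max {S} {m} {w} r≡2 m∈S m-max w∈S 0<m w≡pm with parent (toℕ m) ℕ.≟ 0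
  ... | no pm≢0 =
    pendant-at m∈S w∈S 0<m w≡pm (max-leaf m-max)
               (parent-leaf single-child w≡pm (subst (0 <_) (sym w≡pm) (ℕ.n≢0⇒n>0 pm≢0)))
  ... | yes pm≡0 with (# 1 ∈? S) ×-dec (# 2 ∈? S) | (# 3 ∈? S) ×-dec (# 4 ∈? S)
  ...   | yes (1∈S , 2∈S) | _ =
    pendant-at 2∈S 1∈S (s≤s z≤n) refl (childless-leaf (childless 2 (s≤s z≤n) refl))
               (parent-leaf single-child {c = # 2} refl (s≤s z≤n))
  ...   | no _ | yes (3∈S , 4∈S) =
    pendant-at 4∈S 3∈S (s≤s z≤n) refl (childless-leaf (childless 4 (s≤s z≤n) refl))
               (parent-leaf single-child {c = # 4} refl (s≤s z≤n))
  ...   | no ¬12 | no ¬34 =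
    pendant-at m∈S w∈S 0<m w≡pm (max-leaf m-max) (centre-leaf m-max w≡0 pm≡0 (no-fork r≡2 m-max 0∈S ¬12 ¬34))
    where
    w≡0 : toℕ w ≡ 0
    w≡0 = trans w≡pm pm≡0
    0∈S : # 0 ∈ S
    0∈S = subst (_∈ S) (toℕ-injective w≡0) w∈S

  pendant-exists : ∀ {S} → Connected S → ∣ S ∣ % 3 ≡ 2 → PendantEdge S
  pendant-exists {S} conn r≡2 =
    let m , m∈S , m-max = maximum S (∣p∣≢0⇒Nonempty S ∣S∣≢0)
        w , w∈S , m~w   = has-neighbour conn 2≤∣S∣ m∈S
        0<m , w≡pm      = neighbour-of-max m-max w∈S m~w
    in pendant-near-max r≡2 m∈S m-max w∈S 0<m w≡pm
    where
    2≤∣S∣ : 2 ≤ ∣ S ∣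
    2≤∣S∣ = %3≡2⇒2≤ {∣ S ∣} r≡2
    ∣S∣≢0 : ∣ S ∣ ≢ 0
    ∣S∣≢0 ∣S∣≡0 with subst (2 ≤_) ∣S∣≡0 2≤∣S∣
    ... | ()

  open GrundyMod3 (λ _ → max-leaf-exists) pendant-exists

  𝒢-S₂₂ₖ : 𝒢 G ≡ size G % 3
  𝒢-S₂₂ₖ = 𝒢≡size%3 ⊤-connected

lemma26 : (k : ℕ) →
    (𝒢 (subdividedStar (2 ∷ 2 ∷ k ∷ [])) ≡ ∣ subdividedStar (2 ∷ 2 ∷ k ∷ []) ∣ᵥ % 3)
    × (∣ subdividedStar (2 ∷ 2 ∷ k ∷ []) ∣ᵥ % 3 ≡ (k + 5) % 3)
lemma26 k = Spider₂₂.𝒢-S₂₂ₖ k , cong (_% 3) (trans (cong (5 +_) (ℕ.+-identityʳ k)) (ℕ.+-comm 5 k))
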